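{- Let $G$ be a graph with distinct neighbourhoods and let $(A,B)$ be a proper W-join in $G$. If $(A,B)$ is partitionable and unshatterable, then $G[A\cup B]$ is isomorphic to $C_4$.
   Context: Graphs are finite, simple, undirected; $N(u)$ is the neighbourhood of $u$. Two adjacent vertices $u,v$ have nested neighbourhoods if $N(u)\setminus\{v\}\subseteq N(v)\setminus\{u\}$ or $N(v)\setminus\{u\}\subseteq N(u)\setminus\{v\}$; $G$ has distinct neighbourhoods if no two vertices have nested neighbourhoods. Disjoint sets $S,T$ are complete if every vertex of $S$ is adjacent to every vertex of $T$ and anticomplete if no edge joins them. A pair $(A,B)$ of disjoint non-empty vertex sets is a W-join if $|A|+|B|>2$, $A$ and $B$ are cliques, $A$ is neither complete nor anticomplete to $B$, and every vertex outside $A\cup B$ is either complete or anticomplete to $A$ and either complete or anticomplete to $B$. It is proper if each vertex of $A$ is neither complete nor anticomplete to $B$ and each vertex of $B$ is neither complete nor anticomplete to $A$. A W-join $(A,B)$ is partitionable if there are partitions of $A$ into non-empty sets $A',A''$ and of $B$ into non-empty sets $B',B''$ such that $A'$ is anticomplete to $B''$ and $B'$ is anticomplete to $A''$. A proper W-join is shatterable if it is partitionable with such sets $A',A'',B',B''$ where one of $(A',B')$, $(A'',B'')$ is also a proper W-join, and unshatterable otherwise. -}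

module Defs where

open import Data.Nat using (ℕ; _+_; _>_)
open import Data.Bool using (Bool; true; false)
open import Data.Fin using (Fin; zero; suc)
open import Data.Fin.Subset using (Subset; _∈_; _∉_; _∪_; ∣_∣; Nonempty)
open import Data.Product using (Σ; ∃; _×_; _,_)
open import Data.Sum using (_⊎_)
open import Relation.Nullary using (¬_)
open import Relation.Binary.PropositionalEquality using (_≡_; _≢_)
open import Function.Bundles using (_⇔_)

record Graph : Set where
  field
    n      : ℕ
    adj    : Fin n → Fin n → Bool
    sym    : ∀ u v → adj u v ≡ adj v u
    irrefl : ∀ u → adj u u ≡ false

open Graph public

module _ (G : Graph) where

  V : Set
  V = Fin (n G)

  E : V → V → Set
  E u v = adj G u v ≡ true

  NbhdSub : V → V → Set
  NbhdSub u v = ∀ w → E u w → w ≢ v → E v w × w ≢ u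

  Nested : V → V → Set
  Nested u v = E u v × (NbhdSub u v ⊎ NbhdSub v u)

  DistinctNbhds : Set
  DistinctNbhds = ∀ u v → ¬ Nested u v

  Clique : Subset (n G) → Set
  Clique S = ∀ u v → u ∈ S → v ∈ S → u ≢ v → E u v

  DisjointSets : Subset (n G) → Subset (n G) → Set
  DisjointSets S T = ∀ x → x ∈ S → x ∉ T

  CompleteTo : V → Subset (n G) → Set
  CompleteTo v S = ∀ s → s ∈ S → E v s

  AnticompleteTo : V → Subset (n G) → Set
  AnticompleteTo v S = ∀ s → s ∈ S → ¬ E v s

  Complete : Subset (n G) → Subset (n G) → Set
  Complete S T = ∀ s → s ∈ S → CompleteTo s T

  Anticomplete : Subset (n G) → Subset (n G) → Set
  Anticomplete S T = ∀ s → s ∈ S → AnticompleteTo s T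

  WJoin : Subset (n G) → Subset (n G) → Set
  WJoin A B =
    DisjointSets A B × Nonempty A × Nonempty B ×
    (∣ A ∣ + ∣ B ∣ > 2) ×
    Clique A × Clique B ×
    ¬ Complete A B × ¬ Anticomplete A B ×
    (∀ v → v ∉ A → v ∉ B →
       (CompleteTo v A ⊎ AnticompleteTo v A) ×
       (CompleteTo v B ⊎ AnticompleteTo v B))

  ProperWJoin : Subset (n G) → Subset (n G) → Set
  ProperWJoin A B =
    WJoin A B ×
    (∀ a → a ∈ A → ¬ CompleteTo a B × ¬ AnticompleteTo a B) ×
    (∀ b → b ∈ B → ¬ CompleteTo b A × ¬ AnticompleteTo b A)

  IsPartition : Subset (n G) → Subset (n G) → Subset (n G) → Set
  IsPartition S S′ S″ =
    Nonempty S′ × Nonempty S″ × DisjointSets S′ S″ ×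
    (∀ x → x ∈ S ⇔ (x ∈ S′ ⊎ x ∈ S″))

  PartitionWitness : (A B A′ A″ B′ B″ : Subset (n G)) → Set
  PartitionWitness A B A′ A″ B′ B″ =
    IsPartition A A′ A″ × IsPartition B B′ B″ ×
    Anticomplete A′ B″ × Anticomplete B′ A″

  Partitionable : Subset (n G) → Subset (n G) → Set
  Partitionable A B =
    WJoin A B ×
    Σ (Subset (n G)) λ A′ → Σ (Subset (n G)) λ A″ →
    Σ (Subset (n G)) λ B′ → Σ (Subset (n G)) λ B″ →
      PartitionWitness A B A′ A″ B′ B″

  Shatterable : Subset (n G) → Subset (n G) → Set
  Shatterable A B =
    ProperWJoin A B ×
    Σ (Subset (n G)) λ A′ → Σ (Subset (n G)) λ A″ →
    Σ (Subset (n G)) λ B′ → Σ (Subset (n G)) λ B″ →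
      PartitionWitness A B A′ A″ B′ B″ ×
      (ProperWJoin A′ B′ ⊎ ProperWJoin A″ B″)

  Unshatterable : Subset (n G) → Subset (n G) → Set
  Unshatterable A B = ProperWJoin A B × ¬ Shatterable A B

c4adj : Fin 4 → Fin 4 → Bool
c4adj zero (suc zero) = true
c4adj (suc zero) zero = true
c4adj (suc zero) (suc (suc zero)) = true
c4adj (suc (suc zero)) (suc zero) = true
c4adj (suc (suc zero)) (suc (suc (suc zero))) = true
c4adj (suc (suc (suc zero))) (suc (suc zero)) = true
c4adj (suc (suc (suc zero))) zero = true
c4adj zero (suc (suc (suc zero))) = true
c4adj _ _ = false

InducedIsoC4 : (G : Graph) → Subset (n G) → Set
InducedIsoC4 G S =
  Σ (Fin 4 → Fin (n G)) λ f →
    (∀ i → f i ∈ S) ×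
    (∀ i j → f i ≡ f j → i ≡ j) ×
    (∀ x → x ∈ S → ∃ λ i → f i ≡ x) ×
    (∀ i j → adj G (f i) (f j) ≡ c4adj i j)

module Submission where

-- The key observation (sideDomination) is that two distinct vertices a, x
-- of A can never satisfy N(a) ∩ B ⊆ N(x): inside the clique A and outside
-- A ∪ B their neighbourhoods agree, so the neighbourhood of a would be
-- nested in that of x.  For a half (P , Q) all A–B edges at P go to Q and
-- vice versa (Confined), so a vertex of P complete to Q dominates every
-- other vertex of P, and then every vertex of Q dominates every other;
-- hence P and Q are subsingletons (completeVertex⇒subsingletons).
-- Consequently a half with two vertices on some side is itself a proper
-- W-join (properHalf, contrapositively smallUnlessProper).  Unshatterability
-- therefore forces A′, A″, B′, B″ to be singletons a′, a″, b′, b″, and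
-- a′ b′ b″ a″ is a chordless 4-cycle (singletonPartsC4, via the general
-- cycleInducesC4), which is the theorem lemma13.

open import Defs hiding (sym)
open import Data.Fin.Subset using (Subset; _∪_)

open import Data.Nat using (_+_; _≤_; _<_)
open import Data.Nat.Properties using (+-mono-≤)
open import Data.Bool using (true; false)
open import Data.Bool.Properties using (¬-not)
import Data.Bool as Bool
open import Data.Fin using (Fin; zero; suc; _≟_)
open import Data.Fin.Subset using (_∈_; _∉_; _⊆_; ∣_∣; ⁅_⁆)
open import Data.Fin.Subset.Properties
  using (_∈?_; x∈⁅y⁆⇒x≡y; ∣⁅x⁆∣≡1; p⊆q⇒∣p∣≤∣q∣; p⊂q⇒∣p∣<∣q∣; x∈p∪q⁻; x∈p∪q⁺)
open import Data.Product using (∃; ∃₂; _×_; _,_; proj₁; proj₂)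
import Data.Product as Product
open import Data.Sum using (_⊎_; inj₁; inj₂)
import Data.Sum as Sum
open import Data.Empty using (⊥-elim)
open import Function using (_∘_)
open import Function.Bundles using (Equivalence; mk⇔)
open import Relation.Nullary using (¬_; yes; no)
open import Relation.Nullary.Decidable using (decidable-stable)
open import Relation.Binary.PropositionalEquality
  using (_≡_; _≢_; refl; sym; trans; cong; subst)

⁅⁆⊆ : ∀ {m} {x : Fin m} {p : Subset m} → x ∈ p → ⁅ x ⁆ ⊆ p
⁅⁆⊆ {x = x} {p} x∈p y∈⁅x⁆ = subst (_∈ p) (sym (x∈⁅y⁆⇒x≡y x y∈⁅x⁆)) x∈p

member⇒1≤∣∣ : ∀ {m} {x : Fin m} {p : Subset m} → x ∈ p → 1 ≤ ∣ p ∣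
member⇒1≤∣∣ {x = x} {p} x∈p =
  subst (_≤ ∣ p ∣) (∣⁅x⁆∣≡1 x) (p⊆q⇒∣p∣≤∣q∣ (⁅⁆⊆ x∈p))

twoMembers⇒2≤∣∣ : ∀ {m} {x y : Fin m} {p : Subset m} →
  x ∈ p → y ∈ p → x ≢ y → 2 ≤ ∣ p ∣
twoMembers⇒2≤∣∣ {x = x} {y} {p} x∈p y∈p x≢y =
  subst (_< ∣ p ∣) (∣⁅x⁆∣≡1 x)
    (p⊂q⇒∣p∣<∣q∣ (⁅⁆⊆ x∈p , y , y∈p , λ y∈⁅x⁆ → x≢y (sym (x∈⁅y⁆⇒x≡y x y∈⁅x⁆))))

module _ (G : Graph) where

  private
    variable
      A B P Q A′ A″ B′ B″ : Subset (n G)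
      u v : V G

  E-sym : E G u v → E G v u
  E-sym {u} {v} e = trans (Graph.sym G v u) e

  E-irrefl : ¬ E G u u
  E-irrefl {u} e with trans (sym (irrefl G u)) e
  ... | ()

  E-stable : ¬ ¬ E G u v → E G u v
  E-stable {u} {v} = decidable-stable (adj G u v Bool.≟ true)

  ¬E⇒adj≡false : ¬ E G u v → adj G u v ≡ false
  ¬E⇒adj≡false = ¬-not

  antiSym : Anticomplete G P Q → Anticomplete G Q P
  antiSym anti q q∈Q p p∈P e = anti p p∈P q q∈Q (E-sym e)

  module _ {S S′ S″ : Subset (n G)} (part : IsPartition G S S′ S″) where

    private
      split⇔ = proj₂ (proj₂ (proj₂ part))

    partLeft⊆ : S′ ⊆ S
    partLeft⊆ {x} x∈S′ = Equivalence.from (split⇔ x) (inj₁ x∈S′)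

    partRight⊆ : S″ ⊆ S
    partRight⊆ {x} x∈S″ = Equivalence.from (split⇔ x) (inj₂ x∈S″)

    partSplit : ∀ {x} → x ∈ S → x ∈ S′ ⊎ x ∈ S″
    partSplit {x} = Equivalence.to (split⇔ x)

    partDisjoint : ∀ {x y} → x ∈ S′ → y ∈ S″ → x ≢ y
    partDisjoint {x} x∈S′ y∈S″ refl = proj₁ (proj₂ (proj₂ part)) x x∈S′ y∈S″

  swapPartition : ∀ {S S′ S″} → IsPartition G S S′ S″ → IsPartition G S S″ S′
  swapPartition (ne′ , ne″ , disjoint , split⇔) =
    ne″ , ne′ , (λ x x∈S″ x∈S′ → disjoint x x∈S′ x∈S″) ,
    λ x → mk⇔ (Sum.swap ∘ Equivalence.to (split⇔ x)) (Equivalence.from (split⇔ x) ∘ Sum.swap)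

  Subsingleton : Subset (n G) → Set
  Subsingleton S = ∀ {x y} → x ∈ S → y ∈ S → x ≡ y

  HasTwo : Subset (n G) → Set
  HasTwo S = ∃₂ λ x y → x ∈ S × y ∈ S × x ≢ y

  ¬HasTwo⇒Subsingleton : ∀ {S} → ¬ HasTwo S → Subsingleton S
  ¬HasTwo⇒Subsingleton ¬two {x} {y} x∈S y∈S =
    decidable-stable (x ≟ y) λ x≢y → ¬two (x , y , x∈S , y∈S , x≢y)

  record JoinSide (A B : Subset (n G)) : Set where
    field
      clique      : Clique G A
      homogeneous : ∀ v → v ∉ A → v ∉ B → CompleteTo G v A ⊎ AnticompleteTo G v A

  sideA : WJoin G A B → JoinSide A B
  sideA (_ , _ , _ , _ , cliqueA , _ , _ , _ , out) =
    record { clique = cliqueA ; homogeneous = λ v v∉A v∉B → proj₁ (out v v∉A v∉B) }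

  sideB : WJoin G A B → JoinSide B A
  sideB (_ , _ , _ , _ , _ , cliqueB , _ , _ , out) =
    record { clique = cliqueB ; homogeneous = λ v v∉B v∉A → proj₂ (out v v∉A v∉B) }

  -- Key lemma: in a graph with distinct neighbourhoods, if a, x ∈ A and
  -- every B-neighbour of a is adjacent to x, then a = x; otherwise N(a)
  -- would be nested in N(x), the two agreeing on A and outside A ∪ B.
  sideDomination : ∀ {x a} → DistinctNbhds G → JoinSide A B → x ∈ A → a ∈ A →
    (∀ {w} → w ∈ B → E G a w → E G x w) → a ≡ x
  sideDomination {A} {B} {x} {a} distinct side x∈A a∈A dominated =
    decidable-stable (a ≟ x) λ a≢x →
      distinct a x (clique a x a∈A x∈A a≢x , inj₁ λ w a~w w≢x →
        x~w a~w w≢x , λ w≡a → E-irrefl (subst (E G a) w≡a a~w))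
    where
      open JoinSide side
      x~w : ∀ {w} → E G a w → w ≢ x → E G x w
      x~w {w} a~w w≢x with w ∈? A | w ∈? B
      ... | yes w∈A | _       = clique x w x∈A w∈A (w≢x ∘ sym)
      ... | no _    | yes w∈B = dominated w∈B a~w
      ... | no w∉A  | no w∉B  with homogeneous w w∉A w∉B
      ...   | inj₁ complete     = E-sym (complete x x∈A)
      ...   | inj₂ anticomplete = ⊥-elim (anticomplete a a∈A (E-sym a~w))

  record Confined (A B P Q : Subset (n G)) : Set where
    field
      P⊆A : P ⊆ A
      Q⊆B : Q ⊆ B
      P→Q : ∀ {p w} → p ∈ P → w ∈ B → E G p w → w ∈ Q
      Q→P : ∀ {q w} → q ∈ Q → w ∈ A → E G q w → w ∈ P

  swapConfined : Confined A B P Q → Confined B A Q P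
  swapConfined c = record { P⊆A = Q⊆B ; Q⊆B = P⊆A ; P→Q = Q→P ; Q→P = P→Q }
    where open Confined c

  halfConfined : PartitionWitness G A B A′ A″ B′ B″ → Confined A B A′ B′
  halfConfined {A} {B} {A′} {A″} {B′} {B″} (partA , partB , anti′″ , anti′′) = record
    { P⊆A = partLeft⊆ partA ; Q⊆B = partLeft⊆ partB ; P→Q = P→Q ; Q→P = Q→P }
    where
      P→Q : ∀ {p w} → p ∈ A′ → w ∈ B → E G p w → w ∈ B′
      P→Q {p} {w} p∈A′ w∈B p~w with partSplit partB w∈B
      ... | inj₁ w∈B′ = w∈B′
      ... | inj₂ w∈B″ = ⊥-elim (anti′″ p p∈A′ w w∈B″ p~w)
      Q→P : ∀ {q w} → q ∈ B′ → w ∈ A → E G q w → w ∈ A′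
      Q→P {q} {w} q∈B′ w∈A q~w with partSplit partA w∈A
      ... | inj₁ w∈A′ = w∈A′
      ... | inj₂ w∈A″ = ⊥-elim (anti′′ q q∈B′ w w∈A″ q~w)

  swapWitness : PartitionWitness G A B A′ A″ B′ B″ → PartitionWitness G A B A″ A′ B″ B′
  swapWitness (partA , partB , anti′″ , anti′′) =
    swapPartition partA , swapPartition partB , antiSym anti′′ , antiSym anti′″

  -- A vertex of P complete to Q forces both P and Q to be subsingletons:
  -- it dominates every vertex of P, so P = {x}; then any q′ ∈ Q dominates
  -- any q ∈ Q, since the only A-neighbour of q is x, which is adjacent to q′.
  completeVertex⇒subsingletons : ∀ {x} → DistinctNbhds G →
    JoinSide A B → JoinSide B A → Confined A B P Q →
    x ∈ P → CompleteTo G x Q → Subsingleton P × Subsingleton Q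
  completeVertex⇒subsingletons {P = P} {Q = Q} {x = x} distinct sA sB conf x∈P x-complete =
    (λ p∈P p′∈P → trans (P-is-x p∈P) (sym (P-is-x p′∈P))) , Q-subsingleton
    where
      open Confined conf
      P-is-x : ∀ {p} → p ∈ P → p ≡ x
      P-is-x p∈P = sideDomination distinct sA (P⊆A x∈P) (P⊆A p∈P)
        λ w∈B p~w → x-complete _ (P→Q p∈P w∈B p~w)
      Q-subsingleton : Subsingleton Q
      Q-subsingleton {q} {q′} q∈Q q′∈Q = sideDomination distinct sB (Q⊆B q′∈Q) (Q⊆B q∈Q)
        λ w∈A q~w → subst (E G q′) (sym (P-is-x (Q→P q∈Q w∈A q~w))) (E-sym (x-complete q′ q′∈Q))

  confinedVertexProper : DistinctNbhds G →
    JoinSide A B → JoinSide B A → Confined A B P Q →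
    (∀ a → a ∈ A → ¬ AnticompleteTo G a B) →
    ¬ (Subsingleton P × Subsingleton Q) →
    ∀ p → p ∈ P → ¬ CompleteTo G p Q × ¬ AnticompleteTo G p Q
  confinedVertexProper distinct sA sB conf notAnti large p p∈P =
    (λ complete → large (completeVertex⇒subsingletons distinct sA sB conf p∈P complete)) ,
    (λ anti → notAnti p (P⊆A p∈P) λ w w∈B p~w → anti w (P→Q p∈P w∈B p~w) p~w)
    where open Confined conf

  restrictHomogeneous : P ⊆ A →
    CompleteTo G v A ⊎ AnticompleteTo G v A → CompleteTo G v P ⊎ AnticompleteTo G v P
  restrictHomogeneous P⊆A =
    Sum.map (λ complete s s∈P → complete s (P⊆A s∈P)) (λ anti s s∈P → anti s (P⊆A s∈P))

  -- Vertices outside the first half are homogeneous to each of its sides: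
  -- those of A″ are complete to A′ and anticomplete to B′, symmetrically
  -- for B″, and the rest were already homogeneous to A and to B.
  halfHomogeneous : WJoin G A B → PartitionWitness G A B A′ A″ B′ B″ →
    ∀ v → v ∉ A′ → v ∉ B′ →
    (CompleteTo G v A′ ⊎ AnticompleteTo G v A′) × (CompleteTo G v B′ ⊎ AnticompleteTo G v B′)
  halfHomogeneous {A} {B} wj (partA , partB , anti′″ , anti′′) v v∉A′ v∉B′
    with v ∈? A | v ∈? B
  ... | yes v∈A | _ with partSplit partA v∈A
  ...   | inj₁ v∈A′ = ⊥-elim (v∉A′ v∈A′)
  ...   | inj₂ v∈A″ =
          inj₁ (λ s s∈A′ → JoinSide.clique (sideA wj) v s v∈A (partLeft⊆ partA s∈A′)
                             (partDisjoint partA s∈A′ v∈A″ ∘ sym)) ,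
          inj₂ (λ s s∈B′ v~s → anti′′ s s∈B′ v v∈A″ (E-sym v~s))
  halfHomogeneous wj (partA , partB , anti′″ , anti′′) v v∉A′ v∉B′
      | no _ | yes v∈B with partSplit partB v∈B
  ...   | inj₁ v∈B′ = ⊥-elim (v∉B′ v∈B′)
  ...   | inj₂ v∈B″ =
          inj₂ (λ s s∈A′ v~s → anti′″ s s∈A′ v v∈B″ (E-sym v~s)) ,
          inj₁ (λ s s∈B′ → JoinSide.clique (sideB wj) v s v∈B (partLeft⊆ partB s∈B′)
                             (partDisjoint partB s∈B′ v∈B″ ∘ sym))
  halfHomogeneous wj (partA , partB , _ , _) v _ _ | no v∉A | no v∉B =
    restrictHomogeneous (partLeft⊆ partA) (JoinSide.homogeneous (sideA wj) v v∉A v∉B) ,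
    restrictHomogeneous (partLeft⊆ partB) (JoinSide.homogeneous (sideB wj) v v∉B v∉A)

  properHalf : DistinctNbhds G → ProperWJoin G A B → PartitionWitness G A B A′ A″ B′ B″ →
    HasTwo A′ ⊎ HasTwo B′ → ProperWJoin G A′ B′
  properHalf {A′ = A′} {B′ = B′} distinct (wj , properA , properB)
    witness@((nonemptyA′ , _) , (nonemptyB′ , _) , _) two =
    (disjoint , nonemptyA′ , nonemptyB′ , size ,
     (λ x y x∈A′ y∈A′ → clique (sideA wj) x y (P⊆A x∈A′) (P⊆A y∈A′)) ,
     (λ x y x∈B′ y∈B′ → clique (sideB wj) x y (Q⊆B x∈B′) (Q⊆B y∈B′)) ,
     (λ complete → proj₁ (properA′ a a∈A′) (complete a a∈A′)) ,
     (λ anti → proj₂ (properA′ a a∈A′) (anti a a∈A′)) ,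
     halfHomogeneous wj witness) ,
    properA′ , properB′
    where
      open JoinSide using (clique)
      conf = halfConfined witness
      open Confined conf
      a = proj₁ nonemptyA′
      a∈A′ = proj₂ nonemptyA′
      large : ¬ (Subsingleton A′ × Subsingleton B′)
      large (smallA′ , smallB′) =
        Sum.[ (λ (_ , _ , x∈ , y∈ , x≢y) → x≢y (smallA′ x∈ y∈)) ,
              (λ (_ , _ , x∈ , y∈ , x≢y) → x≢y (smallB′ x∈ y∈)) ] two
      properA′ = confinedVertexProper distinct (sideA wj) (sideB wj) conf
                   (λ x x∈A → proj₂ (properA x x∈A)) large
      properB′ = confinedVertexProper distinct (sideB wj) (sideA wj) (swapConfined conf)
                   (λ x x∈B → proj₂ (properB x x∈B)) (large ∘ Product.swap)
      disjoint : DisjointSets G A′ B′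
      disjoint x x∈A′ x∈B′ = proj₁ wj x (P⊆A x∈A′) (Q⊆B x∈B′)
      size : 2 < ∣ A′ ∣ + ∣ B′ ∣
      size = Sum.[
        (λ (_ , _ , x∈ , y∈ , x≢y) →
          +-mono-≤ (twoMembers⇒2≤∣∣ x∈ y∈ x≢y) (member⇒1≤∣∣ (proj₂ nonemptyB′))) ,
        (λ (_ , _ , x∈ , y∈ , x≢y) →
          +-mono-≤ (member⇒1≤∣∣ a∈A′) (twoMembers⇒2≤∣∣ x∈ y∈ x≢y)) ] two

  smallUnlessProper : DistinctNbhds G → ProperWJoin G A B →
    PartitionWitness G A B A′ A″ B′ B″ → ¬ ProperWJoin G A′ B′ →
    Subsingleton A′ × Subsingleton B′
  smallUnlessProper distinct proper witness notProper =
    ¬HasTwo⇒Subsingleton (notProper ∘ properHalf distinct proper witness ∘ inj₁) ,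
    ¬HasTwo⇒Subsingleton (notProper ∘ properHalf distinct proper witness ∘ inj₂)

  edgeToSubsingleton : ∀ {p q} → Confined A B P Q → Subsingleton Q →
    ¬ AnticompleteTo G p B → p ∈ P → q ∈ Q → E G p q
  edgeToSubsingleton {p = p} conf small notAnti p∈P q∈Q =
    E-stable λ p≁q → notAnti λ w w∈B p~w →
      p≁q (subst (E G p) (small (P→Q p∈P w∈B p~w) q∈Q) p~w)
    where open Confined conf

  cycleMap : V G → V G → V G → V G → Fin 4 → V G
  cycleMap v₀ _  _  _  zero                   = v₀
  cycleMap _  v₁ _  _  (suc zero)             = v₁
  cycleMap _  _  v₂ _  (suc (suc zero))       = v₂
  cycleMap _  _  _  v₃ (suc (suc (suc zero))) = v₃

  cycleAdjacency : ∀ {v₀ v₁ v₂ v₃} →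
    E G v₀ v₁ → E G v₁ v₂ → E G v₂ v₃ → E G v₃ v₀ → ¬ E G v₀ v₂ → ¬ E G v₁ v₃ →
    ∀ i j → adj G (cycleMap v₀ v₁ v₂ v₃ i) (cycleMap v₀ v₁ v₂ v₃ j) ≡ c4adj i j
  cycleAdjacency e₀₁ e₁₂ e₂₃ e₃₀ n₀₂ n₁₃ = go
    where
      go : ∀ i j → adj G (cycleMap _ _ _ _ i) (cycleMap _ _ _ _ j) ≡ c4adj i j
      go zero                   zero                   = irrefl G _
      go zero                   (suc zero)             = e₀₁
      go zero                   (suc (suc zero))       = ¬E⇒adj≡false n₀₂
      go zero                   (suc (suc (suc zero))) = E-sym e₃₀
      go (suc zero)             zero                   = E-sym e₀₁
      go (suc zero)             (suc zero)             = irrefl G _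
      go (suc zero)             (suc (suc zero))       = e₁₂
      go (suc zero)             (suc (suc (suc zero))) = ¬E⇒adj≡false n₁₃
      go (suc (suc zero))       zero                   = ¬E⇒adj≡false (n₀₂ ∘ E-sym)
      go (suc (suc zero))       (suc zero)             = E-sym e₁₂
      go (suc (suc zero))       (suc (suc zero))       = irrefl G _
      go (suc (suc zero))       (suc (suc (suc zero))) = e₂₃
      go (suc (suc (suc zero))) zero                   = e₃₀
      go (suc (suc (suc zero))) (suc zero)             = ¬E⇒adj≡false (n₁₃ ∘ E-sym)
      go (suc (suc (suc zero))) (suc (suc zero))       = E-sym e₂₃
      go (suc (suc (suc zero))) (suc (suc (suc zero))) = irrefl G _

  -- A labelling with the adjacency of C₄ is injective once opposite
  -- vertices are distinct: equal labels force a non-edge of C₄, and the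
  -- only non-edges between different positions join opposite vertices.
  cycleInjective : (f : Fin 4 → V G) → (∀ i j → adj G (f i) (f j) ≡ c4adj i j) →
    f zero ≢ f (suc (suc zero)) → f (suc zero) ≢ f (suc (suc (suc zero))) →
    ∀ i j → f i ≡ f j → i ≡ j
  cycleInjective f adjacency d₀₂ d₁₃ i j fi≡fj = go i j nonEdge fi≡fj
    where
      nonEdge : c4adj i j ≡ false
      nonEdge = trans (sym (adjacency i j))
                      (trans (cong (adj G (f i)) (sym fi≡fj)) (irrefl G (f i)))
      go : ∀ i j → c4adj i j ≡ false → f i ≡ f j → i ≡ j
      go zero                   zero                   _  _ = refl
      go zero                   (suc (suc zero))       _  e = ⊥-elim (d₀₂ e)
      go (suc zero)             (suc zero)             _  _ = refl
      go (suc zero)             (suc (suc (suc zero))) _  e = ⊥-elim (d₁₃ e)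
      go (suc (suc zero))       zero                   _  e = ⊥-elim (d₀₂ (sym e))
      go (suc (suc zero))       (suc (suc zero))       _  _ = refl
      go (suc (suc (suc zero))) (suc zero)             _  e = ⊥-elim (d₁₃ (sym e))
      go (suc (suc (suc zero))) (suc (suc (suc zero))) _  _ = refl
      go zero                   (suc zero)             () _
      go zero                   (suc (suc (suc zero))) () _
      go (suc zero)             zero                   () _
      go (suc zero)             (suc (suc zero))       () _
      go (suc (suc zero))       (suc zero)             () _
      go (suc (suc zero))       (suc (suc (suc zero))) () _
      go (suc (suc (suc zero))) zero                   () _
      go (suc (suc (suc zero))) (suc (suc zero))       () _

  cycleInducesC4 : ∀ {S v₀ v₁ v₂ v₃} →
    (∀ i → cycleMap v₀ v₁ v₂ v₃ i ∈ S) →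
    (∀ x → x ∈ S → ∃ λ i → cycleMap v₀ v₁ v₂ v₃ i ≡ x) →
    E G v₀ v₁ → E G v₁ v₂ → E G v₂ v₃ → E G v₃ v₀ → ¬ E G v₀ v₂ → ¬ E G v₁ v₃ →
    v₀ ≢ v₂ → v₁ ≢ v₃ → InducedIsoC4 G S
  cycleInducesC4 inS covers e₀₁ e₁₂ e₂₃ e₃₀ n₀₂ n₁₃ d₀₂ d₁₃ =
    cycleMap _ _ _ _ , inS , cycleInjective (cycleMap _ _ _ _) adjacency d₀₂ d₁₃ ,
    covers , adjacency
    where adjacency = cycleAdjacency e₀₁ e₁₂ e₂₃ e₃₀ n₀₂ n₁₃

  singletonPartsC4 : ProperWJoin G A B → PartitionWitness G A B A′ A″ B′ B″ →
    Subsingleton A′ × Subsingleton B′ → Subsingleton A″ × Subsingleton B″ →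
    InducedIsoC4 G (A ∪ B)
  singletonPartsC4 {A} {B} ((disjoint , _ , _ , _ , cliqueA , cliqueB , _) , properA , _)
    witness@(partA@((a′ , a′∈) , (a″ , a″∈) , _) , partB@((b′ , b′∈) , (b″ , b″∈) , _) ,
             anti′″ , anti′′)
    (smallA′ , smallB′) (smallA″ , smallB″) =
    cycleInducesC4 inS covers
      (edgeToSubsingleton first smallB′ (notAnti a′∈A) a′∈ b′∈)
      (cliqueB b′ b″ b′∈B b″∈B (partDisjoint partB b′∈ b″∈))
      (E-sym (edgeToSubsingleton second smallB″ (notAnti a″∈A) a″∈ b″∈))
      (cliqueA a″ a′ a″∈A a′∈A (partDisjoint partA a′∈ a″∈ ∘ sym))
      (anti′″ a′ a′∈ b″ b″∈) (anti′′ b′ b′∈ a″ a″∈)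
      (A≢B a′∈A b″∈B) (A≢B a″∈A b′∈B ∘ sym)
    where
      first = halfConfined witness
      second = halfConfined (swapWitness witness)
      notAnti : ∀ {a} → a ∈ A → ¬ AnticompleteTo G a B
      notAnti a∈A = proj₂ (properA _ a∈A)
      A≢B : ∀ {x y} → x ∈ A → y ∈ B → x ≢ y
      A≢B x∈A y∈B refl = disjoint _ x∈A y∈B
      a′∈A = partLeft⊆ partA a′∈
      a″∈A = partRight⊆ partA a″∈
      b′∈B = partLeft⊆ partB b′∈
      b″∈B = partRight⊆ partB b″∈
      inS : ∀ i → cycleMap a′ b′ b″ a″ i ∈ A ∪ B
      inS zero                   = x∈p∪q⁺ (inj₁ a′∈A)
      inS (suc zero)             = x∈p∪q⁺ (inj₂ b′∈B)
      inS (suc (suc zero))       = x∈p∪q⁺ (inj₂ b″∈B)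
      inS (suc (suc (suc zero))) = x∈p∪q⁺ (inj₁ a″∈A)
      covers : ∀ x → x ∈ A ∪ B → ∃ λ i → cycleMap a′ b′ b″ a″ i ≡ x
      covers x x∈A∪B with x∈p∪q⁻ A B x∈A∪B
      ... | inj₁ x∈A with partSplit partA x∈A
      ...   | inj₁ x∈A′ = zero , smallA′ a′∈ x∈A′
      ...   | inj₂ x∈A″ = suc (suc (suc zero)) , smallA″ a″∈ x∈A″
      covers x _ | inj₂ x∈B with partSplit partB x∈B
      ...   | inj₁ x∈B′ = suc zero , smallB′ b′∈ x∈B′
      ...   | inj₂ x∈B″ = suc (suc zero) , smallB″ b″∈ x∈B″

lemma13 : (G : Graph) → (A B : Subset (n G)) →
    DistinctNbhds G → ProperWJoin G A B →
    Partitionable G A B → Unshatterable G A B →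
    InducedIsoC4 G (A ∪ B)
lemma13 G A B distinct proper (_ , A′ , A″ , B′ , B″ , witness) (_ , notShatterable) =
  singletonPartsC4 G proper witness
    (smallUnlessProper G distinct proper witness
      λ firstProper → notShatterable (shattering (inj₁ firstProper)))
    (smallUnlessProper G distinct proper (swapWitness G witness)
      λ secondProper → notShatterable (shattering (inj₂ secondProper)))
  where
    shattering : ProperWJoin G A′ B′ ⊎ ProperWJoin G A″ B″ → Shatterable G A B
    shattering halfProper = proper , A′ , A″ , B′ , B″ , witness , halfProper
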